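{- Let $n = p_1^{k_1} p_2^{k_2} \cdots p_r^{k_r}$ be the prime factorization of a positive integer $n$, with distinct primes $p_i$ and integers $k_i \ge 1$, and let $D = \prod_{i=1}^r (k_i+1)$ be the number of divisors of $n$. Then the First and Second Zagreb indices of the divisor prime graph $G_{Dp(n)}$ are $$M_1(G_{Dp(n)}) = \prod_{i=1}^r \left( (k_i+1)^2 + k_i \right) - 2D + 1,$$ $$M_2(G_{Dp(n)}) = \frac{1}{2}\left[ D\prod_{i=1}^r (3k_i+1) - 2\prod_{i=1}^r (2k_i+1) - D^2 + 2D \right].$$
   Context: For a positive integer $n$, the divisor prime graph $G_{Dp(n)}$ is the simple graph whose vertex set is the set of positive divisors of $n$, in which two distinct vertices $x, y$ are adjacent if and only if $\gcd(x,y) = 1$ (no loops). For a graph $G$ with degree function $d(\cdot)$ and edge set $E$, the First Zagreb index is $M_1(G) = \sum_{v \in V(G)} d(v)^2$ and the Second Zagreb index is $M_2(G) = \sum_{uv \in E} d(u)d(v)$. -}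

module Defs where

open import Data.Nat using (ℕ; suc; _+_; _*_; _^_; _≤_; _<_; _≟_; _<?_)
open import Data.Nat.Divisibility using (_∣_; _∣?_)
open import Data.Nat.GCD using (gcd)
open import Data.Nat.Primality using (Prime)
open import Data.List using (List; []; _∷_; map; filter; upTo; length; concatMap)
open import Data.Nat.ListAction using (sum; product)
open import Data.List.Relation.Unary.All using (All)
open import Data.List.Relation.Unary.Unique.Propositional using (Unique)
open import Data.Product using (_×_; _,_; proj₁; proj₂)
open import Relation.Binary.PropositionalEquality using (_≡_; _≢_)
open import Relation.Nullary using (Dec; ¬_)
open import Relation.Nullary.Decidable using (_×-dec_; ¬?)

-- The vertex set of G_{Dp(n)}: the positive divisors of n, listed increasingly
-- (searched in 1..n; for n ≥ 1 these are exactly all positive divisors).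
divisors : ℕ → List ℕ
divisors n = filter (λ d → d ∣? n) (map suc (upTo n))

Adj : ℕ → ℕ → Set
Adj x y = (x ≢ y) × (gcd x y ≡ 1)

adj? : (x y : ℕ) → Dec (Adj x y)
adj? x y = ¬? (x ≟ y) ×-dec (gcd x y ≟ 1)

degree : ℕ → ℕ → ℕ
degree n v = length (filter (adj? v) (divisors n))

-- Edge set of G_{Dp(n)}: each unordered edge {x,y} listed once as (x , y) with x < y.
edges : ℕ → List (ℕ × ℕ)
edges n = concatMap (λ x → map (λ y → (x , y))
                      (filter (λ y → (x <? y) ×-dec adj? x y) (divisors n)))
                    (divisors n)

M₁ : ℕ → ℕ
M₁ n = sum (map (λ v → degree n v * degree n v) (divisors n))

M₂ : ℕ → ℕ
M₂ n = sum (map (λ e → degree n (proj₁ e) * degree n (proj₂ e)) (edges n))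

-- A prime factorization p₁^k₁ ⋯ p_r^k_r given as the list of pairs (pᵢ , kᵢ).
ValidFactorization : List (ℕ × ℕ) → Set
ValidFactorization fs = All (λ e → Prime (proj₁ e) × (1 ≤ proj₂ e)) fs × Unique (map proj₁ fs)

evalFactorization : List (ℕ × ℕ) → ℕ
evalFactorization fs = product (map (λ e → proj₁ e ^ proj₂ e) fs)

prodExp : (ℕ → ℕ) → List (ℕ × ℕ) → ℕ
prodExp f fs = product (map (λ e → f (proj₂ e)) fs)

{-# OPTIONS --safe #-}
-- Write c(x) for the number of divisors of n coprime to x. Since 1 is the only number coprime
-- to itself, deg x = c(x) − [x = 1]. The divisors of n = ∏ pᵢ^kᵢ are the ∏ pᵢ^aᵢ with 0 ≤ aᵢ ≤ kᵢ,
-- and two of them are coprime iff at every pᵢ one of the two exponents vanishes. Hence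
-- c(∏ pᵢ^aᵢ) = ∏ w(kᵢ, aᵢ) with w(k, 0) = k + 1 and w(k, a) = 1 for a > 0, so Σ c(x), Σ c(x)² and
-- Σ_{x ⊥ y} c(x) c(y) factor as ∏ (2kᵢ + 1), ∏ ((kᵢ + 1)² + kᵢ) and ∏ (kᵢ + 1)(3kᵢ + 1), while
-- c(1) = D. Substituting deg = c − [· = 1] into M₁ = Σ deg(x)² and 2 M₂ = Σ_{x ~ y} deg(x) deg(y)
-- (over ordered pairs) gives both formulas.
module Submission where

open import Algebra.Properties.CommutativeSemigroup using (interchange)
open import Data.Bool using (true; false; if_then_else_)
open import Data.List using (List; []; _∷_; [_]; _++_; map; filter; length; concatMap; cartesianProductWith; applyUpTo; upTo)
open import Data.List.Properties using (map-++; map-∘; map-cong; map-cong-local; map-upTo; length-upTo; length-++; length-map)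
open import Data.List.Membership.Propositional using (_∈_; _∉_)
open import Data.List.Membership.Propositional.Properties
  using ( ∈-cartesianProductWith⁺; ∈-cartesianProductWith⁻; ∈-upTo⁺; ∈-upTo⁻; ∈-map⁺; ∈-map⁻
        ; ∈-filter⁺; ∈-filter⁻)
open import Data.List.Membership.Propositional.Properties.WithK using (unique∧set⇒bag)
open import Data.List.Relation.Binary.BagAndSetEquality using (∼bag⇒↭)
open import Data.List.Relation.Binary.Disjoint.Propositional using (Disjoint)
open import Data.List.Relation.Binary.Permutation.Propositional using (_↭_)
import Data.List.Relation.Binary.Permutation.Propositional.Properties as ↭
open import Data.List.Relation.Unary.All as All using (All; []; _∷_)
open import Data.List.Relation.Unary.All.Properties using (All¬⇒¬Any) renaming (map⁺ to All-map⁺)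
open import Data.List.Relation.Unary.AllPairs using ([]; _∷_)
open import Data.List.Relation.Unary.Any using (here; there)
open import Data.List.Relation.Unary.Unique.Propositional using (Unique)
import Data.List.Relation.Unary.Unique.Propositional.Properties as Unique
open import Data.Nat
  using (ℕ; zero; suc; _+_; _*_; _^_; _≤_; _<_; _≟_; _<?_; NonZero; z≤n; s≤s; s≤s⁻¹; nonTrivial⇒≢1; ≢-nonZero⁻¹)
open import Data.Nat.Coprimality using (Coprime; coprime?; coprime-divisor; 1-coprimeTo; coprime⇒gcd≡1; gcd≡1⇒coprime)
import Data.Nat.Coprimality as Coprime
open import Data.Nat.Divisibility
open import Data.Nat.GCD using (gcd-comm)
open import Data.Nat.ListAction using (sum)
open import Data.Nat.ListAction.Properties using (sum-++; sum-↭; product≢0)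
open import Data.Nat.Primality using (Prime; prime⇒irreducible; prime⇒nonZero; prime⇒nonTrivial)
open import Data.Nat.Properties
open import Data.Nat.Tactic.RingSolver using (solve-∀)
open import Data.Product using (_×_; _,_; proj₁; proj₂; ∃₂)
open import Data.Sum using (inj₁; inj₂; [_,_]′)
open import Function using (_∘_; _⇔_; mk⇔; Equivalence)
open import Relation.Nullary using (Dec; yes; no; does; ¬_; contradiction)
open import Relation.Nullary.Decidable using (_×-dec_)
open import Relation.Unary using (Pred; Decidable)
open import Relation.Binary.Definitions using (tri<; tri≈; tri>)
open import Relation.Binary.PropositionalEquality
  using (_≡_; _≢_; refl; sym; trans; cong; cong₂; subst; subst₂; module ≡-Reasoning)
open ≡-Reasoning
open import Defs

private variable
  A B C : Set
  P Q : Set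
  a b k m n x y e f p : ℕ
  L : List ℕ
  fs : List (ℕ × ℕ)

-- Indicators and sums over lists

𝟙 : Dec P → ℕ
𝟙 P? = if does P? then 1 else 0

𝟙-yes : (P? : Dec P) → P → 𝟙 P? ≡ 1
𝟙-yes (yes _) _ = refl
𝟙-yes (no ¬p) p = contradiction p ¬p

𝟙-no : (P? : Dec P) → ¬ P → 𝟙 P? ≡ 0
𝟙-no (yes p) ¬p = contradiction p ¬p
𝟙-no (no _) _ = refl

𝟙-⇔ : P ⇔ Q → (P? : Dec P) (Q? : Dec Q) → 𝟙 P? ≡ 𝟙 Q?
𝟙-⇔ P⇔Q (yes p) Q? = sym (𝟙-yes Q? (Equivalence.to P⇔Q p))
𝟙-⇔ P⇔Q (no ¬p) Q? = sym (𝟙-no Q? (¬p ∘ Equivalence.from P⇔Q))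

𝟙-×-dec : (P? : Dec P) (Q? : Dec Q) → 𝟙 (P? ×-dec Q?) ≡ 𝟙 P? * 𝟙 Q?
𝟙-×-dec (yes _) (yes _) = refl
𝟙-×-dec (yes _) (no _) = refl
𝟙-×-dec (no _) _ = refl

𝟙-idem : (P? : Dec P) → 𝟙 P? * 𝟙 P? ≡ 𝟙 P?
𝟙-idem (yes _) = refl
𝟙-idem (no _) = refl

∑ : List A → (A → ℕ) → ℕ
∑ xs f = sum (map f xs)

infix 5 ∑
syntax ∑ xs (λ x → t) = ∑[ x ∈ xs ] t

∑-cong : ∀ (xs : List A) {f g : A → ℕ} → (∀ x → f x ≡ g x) → ∑ xs f ≡ ∑ xs g
∑-cong xs f≗g = cong sum (map-cong f≗g xs)

∑-cong-local : ∀ (xs : List A) {f g : A → ℕ} → (∀ {x} → x ∈ xs → f x ≡ g x) → ∑ xs f ≡ ∑ xs g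
∑-cong-local xs f≗g = cong sum (map-cong-local (All.tabulate f≗g))

∑-+ : ∀ (xs : List A) (f g : A → ℕ) → ∑[ x ∈ xs ] (f x + g x) ≡ ∑ xs f + ∑ xs g
∑-+ [] f g = refl
∑-+ (x ∷ xs) f g =
  trans (cong ((f x + g x) +_) (∑-+ xs f g)) (interchange +-commutativeSemigroup (f x) (g x) _ _)

∑-*ˡ : ∀ (xs : List A) c (f : A → ℕ) → ∑[ x ∈ xs ] (c * f x) ≡ c * ∑ xs f
∑-*ˡ [] c f = sym (*-zeroʳ c)
∑-*ˡ (x ∷ xs) c f = trans (cong (c * f x +_) (∑-*ˡ xs c f)) (sym (*-distribˡ-+ c (f x) _))

∑-*ʳ : ∀ (xs : List A) c (f : A → ℕ) → ∑[ x ∈ xs ] (f x * c) ≡ ∑ xs f * c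
∑-*ʳ xs c f = begin
  ∑[ x ∈ xs ] (f x * c) ≡⟨ ∑-cong xs (λ x → *-comm (f x) c) ⟩
  ∑[ x ∈ xs ] (c * f x) ≡⟨ ∑-*ˡ xs c f ⟩
  c * ∑ xs f            ≡⟨ *-comm c _ ⟩
  ∑ xs f * c            ∎

∑-const : ∀ (xs : List A) c → ∑[ _ ∈ xs ] c ≡ length xs * c
∑-const [] c = refl
∑-const (x ∷ xs) c = cong (c +_) (∑-const xs c)

∑-++ : ∀ (xs ys : List A) (f : A → ℕ) → ∑ (xs ++ ys) f ≡ ∑ xs f + ∑ ys f
∑-++ xs ys f = trans (cong sum (map-++ f xs ys)) (sum-++ (map f xs) (map f ys))

∑-map : ∀ (g : A → B) xs (f : B → ℕ) → ∑ (map g xs) f ≡ ∑ xs (f ∘ g)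
∑-map g xs f = cong sum (sym (map-∘ xs))

∑-concatMap : ∀ (g : A → List B) xs (f : B → ℕ) → ∑ (concatMap g xs) f ≡ ∑[ x ∈ xs ] ∑ (g x) f
∑-concatMap g [] f = refl
∑-concatMap g (x ∷ xs) f = trans (∑-++ (g x) (concatMap g xs) f) (cong (∑ (g x) f +_) (∑-concatMap g xs f))

∑-cartesianProductWith : ∀ (g : A → B → C) xs ys (f : C → ℕ) →
  ∑ (cartesianProductWith g xs ys) f ≡ ∑[ x ∈ xs ] ∑[ y ∈ ys ] f (g x y)
∑-cartesianProductWith g [] ys f = refl
∑-cartesianProductWith g (x ∷ xs) ys f =
  trans (∑-++ (map (g x) ys) _ f) (cong₂ _+_ (∑-map (g x) ys f) (∑-cartesianProductWith g xs ys f))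

∑-cartesianProductWith-* : ∀ (g : A → B → C) xs ys {f : C → ℕ} (α : A → ℕ) (β : B → ℕ) →
  (∀ x {y} → y ∈ ys → f (g x y) ≡ α x * β y) →
  ∑ (cartesianProductWith g xs ys) f ≡ ∑ xs α * ∑ ys β
∑-cartesianProductWith-* g xs ys {f} α β separable = begin
  ∑ (cartesianProductWith g xs ys) f  ≡⟨ ∑-cartesianProductWith g xs ys f ⟩
  ∑[ x ∈ xs ] ∑[ y ∈ ys ] f (g x y)   ≡⟨ ∑-cong xs (λ x → ∑-cong-local ys (separable x)) ⟩
  ∑[ x ∈ xs ] ∑[ y ∈ ys ] α x * β y   ≡⟨ ∑-cong xs (λ x → ∑-*ˡ ys (α x) β) ⟩
  ∑[ x ∈ xs ] α x * ∑ ys β            ≡⟨ ∑-*ʳ xs _ α ⟩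
  ∑ xs α * ∑ ys β                     ∎

∑∑-+ : ∀ (xs : List A) (ys : List B) (F G : A → B → ℕ) →
  ∑[ x ∈ xs ] ∑[ y ∈ ys ] (F x y + G x y)
  ≡ (∑[ x ∈ xs ] ∑[ y ∈ ys ] F x y) + (∑[ x ∈ xs ] ∑[ y ∈ ys ] G x y)
∑∑-+ xs ys F G =
  trans (∑-cong xs (λ x → ∑-+ ys (F x) (G x))) (∑-+ xs (λ x → ∑[ y ∈ ys ] F x y) (λ x → ∑[ y ∈ ys ] G x y))

∑-swap : ∀ (xs : List A) (ys : List B) (F : A → B → ℕ) →
  ∑[ x ∈ xs ] ∑[ y ∈ ys ] F x y ≡ ∑[ y ∈ ys ] ∑[ x ∈ xs ] F x y
∑-swap [] ys F = sym (trans (∑-const ys 0) (*-zeroʳ (length ys)))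
∑-swap (x ∷ xs) ys F =
  trans (cong (∑ ys (F x) +_) (∑-swap xs ys F)) (sym (∑-+ ys (F x) (λ y → ∑[ x ∈ xs ] F x y)))

∑-filter : ∀ {R : Pred A _} (R? : Decidable R) xs (f : A → ℕ) →
  ∑ (filter R? xs) f ≡ ∑[ x ∈ xs ] (𝟙 (R? x) * f x)
∑-filter R? [] f = refl
∑-filter R? (x ∷ xs) f with does (R? x)
... | true  = cong₂ _+_ (sym (+-identityʳ (f x))) (∑-filter R? xs f)
... | false = ∑-filter R? xs f

length-filter : ∀ {R : Pred A _} (R? : Decidable R) xs → length (filter R? xs) ≡ ∑[ x ∈ xs ] 𝟙 (R? x)
length-filter R? [] = refl
length-filter R? (x ∷ xs) with does (R? x)
... | true  = cong suc (length-filter R? xs)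
... | false = length-filter R? xs

∑-↭ : ∀ {xs ys : List A} (f : A → ℕ) → xs ↭ ys → ∑ xs f ≡ ∑ ys f
∑-↭ f xs↭ys = sum-↭ (↭.map⁺ f xs↭ys)

∑-unique : ∀ {xs ys : List A} (f : A → ℕ) → Unique xs → Unique ys →
  (∀ {x} → x ∈ xs ⇔ x ∈ ys) → ∑ xs f ≡ ∑ ys f
∑-unique f xs! ys! xs≈ys = ∑-↭ f (∼bag⇒↭ (unique∧set⇒bag xs! ys! xs≈ys))

∑-𝟙≡-∉ : ∀ {xs} (g : ℕ → ℕ) → x ∉ xs → ∑[ y ∈ xs ] (𝟙 (y ≟ x) * g y) ≡ 0
∑-𝟙≡-∉ {xs = []} g x∉ = refl
∑-𝟙≡-∉ {x} {y ∷ xs} g x∉ =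
  cong₂ _+_ (cong (_* g y) (𝟙-no (y ≟ x) (x∉ ∘ here ∘ sym))) (∑-𝟙≡-∉ g (x∉ ∘ there))

∑-𝟙≡ : ∀ {xs} (g : ℕ → ℕ) → Unique xs → x ∈ xs → ∑[ y ∈ xs ] (𝟙 (y ≟ x) * g y) ≡ g x
∑-𝟙≡ {x} {_ ∷ xs} g (x∉ ∷ _) (here refl) = begin
  𝟙 (x ≟ x) * g x + (∑[ y ∈ xs ] 𝟙 (y ≟ x) * g y)
    ≡⟨ cong₂ _+_ (cong (_* g x) (𝟙-yes (x ≟ x) refl)) (∑-𝟙≡-∉ g (All¬⇒¬Any x∉)) ⟩
  1 * g x + 0 ≡⟨ trans (+-identityʳ _) (*-identityˡ (g x)) ⟩
  g x         ∎
∑-𝟙≡ {x} {y ∷ xs} g (y∉ ∷ xs!) (there x∈) =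
  trans (cong (_+ (∑[ z ∈ xs ] 𝟙 (z ≟ x) * g z)) (cong (_* g y) (𝟙-no (y ≟ x) (All.lookup y∉ x∈))))
        (∑-𝟙≡ g xs! x∈)

unique-map-local : ∀ (h : A → B) {ys} → (∀ {y z} → y ∈ ys → z ∈ ys → h y ≡ h z → y ≡ z) →
  Unique ys → Unique (map h ys)
unique-map-local h {[]} _ [] = []
unique-map-local h {y ∷ ys} h-inj (y∉ ∷ ys!) =
  All-map⁺ (All.tabulate λ z∈ hy≡hz → All.lookup y∉ z∈ (h-inj (here refl) (there z∈) hy≡hz))
  ∷ unique-map-local h (λ y∈ z∈ → h-inj (there y∈) (there z∈)) ys!

unique-cartesianProductWith-local : ∀ (g : A → B → C) {xs ys} →
  (∀ {a b c d} → b ∈ ys → d ∈ ys → g a b ≡ g c d → a ≡ c × b ≡ d) →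
  Unique xs → Unique ys → Unique (cartesianProductWith g xs ys)
unique-cartesianProductWith-local g g-inj [] ys! = []
unique-cartesianProductWith-local g {x ∷ xs} {ys} g-inj (x∉ ∷ xs!) ys! = Unique.++⁺
  (unique-map-local (g x) (λ b∈ d∈ eq → proj₂ (g-inj b∈ d∈ eq)) ys!)
  (unique-cartesianProductWith-local g g-inj xs! ys!)
  disjoint
  where
  disjoint : Disjoint (map (g x) ys) (cartesianProductWith g xs ys)
  disjoint (v∈map , v∈prod) with ∈-map⁻ (g x) v∈map | ∈-cartesianProductWith⁻ g xs ys v∈prod
  ... | b , b∈ , refl | c , d , c∈ , d∈ , eq = All.lookup x∉ c∈ (proj₁ (g-inj b∈ d∈ eq))

-- Coprimality and prime powers

prime≢1 : Prime p → p ≢ 1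
prime≢1 p-prime = nonTrivial⇒≢1 {{prime⇒nonTrivial p-prime}}

prime∤⇒coprime : Prime p → ¬ p ∣ n → Coprime p n
prime∤⇒coprime p-prime p∤n (d∣p , d∣n) with prime⇒irreducible p-prime d∣p
... | inj₁ d≡1  = d≡1
... | inj₂ refl = contradiction d∣n p∤n

coprime⇒∤ : Prime p → Coprime p n → ¬ p ∣ n
coprime⇒∤ p-prime p⊥n p∣n = prime≢1 p-prime (p⊥n (∣-refl , p∣n))

distinct-primes-coprime : Prime p → Prime m → p ≢ m → Coprime p m
distinct-primes-coprime p-prime m-prime p≢m = prime∤⇒coprime p-prime λ p∣m →
  [ prime≢1 p-prime , p≢m ]′ (prime⇒irreducible m-prime p∣m)

coprime-*ʳ : Coprime m n → Coprime m e → Coprime m (n * e)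
coprime-*ʳ {n = n} m⊥n m⊥e {d} (d∣m , d∣ne) = m⊥e (d∣m , coprime-divisor d⊥n d∣ne)
  where
  d⊥n : Coprime d n
  d⊥n (i∣d , i∣n) = m⊥n (∣-trans i∣d d∣m , i∣n)

coprime-*ˡ : Coprime m e → Coprime n e → Coprime (m * n) e
coprime-*ˡ m⊥e n⊥e = Coprime.sym (coprime-*ʳ (Coprime.sym m⊥e) (Coprime.sym n⊥e))

coprime-^ˡ : ∀ a → Coprime m n → Coprime (m ^ a) n
coprime-^ˡ zero    _   = 1-coprimeTo _
coprime-^ˡ (suc a) m⊥n = coprime-*ˡ m⊥n (coprime-^ˡ a m⊥n)

coprime-^ʳ : ∀ a → Coprime m n → Coprime m (n ^ a)
coprime-^ʳ a = Coprime.sym ∘ coprime-^ˡ a ∘ Coprime.sym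

coprime-*-⇔ : Coprime m f → Coprime e n → Coprime (m * e) (n * f) ⇔ (Coprime m n × Coprime e f)
coprime-*-⇔ {m} {f} {e} {n} m⊥f e⊥n = mk⇔ split join
  where
  split : Coprime (m * e) (n * f) → Coprime m n × Coprime e f
  split me⊥nf = (λ (d∣m , d∣n) → me⊥nf (∣m⇒∣m*n e d∣m , ∣m⇒∣m*n f d∣n))
              , (λ (d∣e , d∣f) → me⊥nf (∣n⇒∣m*n m d∣e , ∣n⇒∣m*n n d∣f))
  join : Coprime m n × Coprime e f → Coprime (m * e) (n * f)
  join (m⊥n , e⊥f) = coprime-*ˡ (coprime-*ʳ m⊥n m⊥f) (coprime-*ʳ e⊥n e⊥f)

^-monoʳ-∣ : ∀ m → a ≤ b → m ^ a ∣ m ^ b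
^-monoʳ-∣ {b = b} m z≤n = 1∣ (m ^ b)
^-monoʳ-∣ m (s≤s a≤b) = *-monoʳ-∣ m (^-monoʳ-∣ m a≤b)

powersCoprime : ℕ → ℕ → ℕ
powersCoprime zero    _       = 1
powersCoprime (suc _) zero    = 1
powersCoprime (suc _) (suc _) = 0

p∣p^[1+a]*e : ∀ p a e → p ∣ p ^ suc a * e
p∣p^[1+a]*e p a e = ∣m⇒∣m*n e (m∣m*n (p ^ a))

𝟙-coprime-^ : Prime p → ∀ a b → 𝟙 (coprime? (p ^ a) (p ^ b)) ≡ powersCoprime a b
𝟙-coprime-^ {p} p-prime zero b      = 𝟙-yes (coprime? 1 (p ^ b)) (1-coprimeTo _)
𝟙-coprime-^ {p} p-prime (suc a) zero = 𝟙-yes (coprime? (p ^ suc a) 1) (Coprime.sym (1-coprimeTo _))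
𝟙-coprime-^ {p} p-prime (suc a) (suc b) = 𝟙-no (coprime? (p ^ suc a) (p ^ suc b)) λ p^a⊥p^b →
  prime≢1 p-prime (p^a⊥p^b (m∣m*n (p ^ a) , m∣m*n (p ^ b)))

∣p^k*m⇒≡p^a*e : Prime p → ¬ p ∣ m → ∀ k → x ∣ p ^ k * m → ∃₂ λ a e → a ≤ k × e ∣ m × x ≡ p ^ a * e
∣p^k*m⇒≡p^a*e {m = m} {x} p-prime p∤m zero x∣m =
  0 , x , z≤n , subst (x ∣_) (*-identityˡ m) x∣m , sym (*-identityˡ x)
∣p^k*m⇒≡p^a*e {p} {m} {x} p-prime p∤m (suc k) x∣ with p ∣? x
... | yes (divides q refl) =
  let a , e , a≤k , e∣m , q≡p^a*e = ∣p^k*m⇒≡p^a*e p-prime p∤m k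
        (*-cancelˡ-∣ p {{prime⇒nonZero p-prime}} (subst₂ _∣_ (*-comm q p) (*-assoc p (p ^ k) m) x∣))
  in suc a , e , s≤s a≤k , e∣m ,
     trans (cong (_* p) q≡p^a*e) (trans (*-comm _ p) (sym (*-assoc p (p ^ a) e)))
... | no p∤x =
  let a , e , a≤k , e∣m , x≡p^a*e = ∣p^k*m⇒≡p^a*e p-prime p∤m k
        (coprime-divisor (Coprime.sym (prime∤⇒coprime p-prime p∤x)) (subst (x ∣_) (*-assoc p (p ^ k) m) x∣))
  in a , e , m≤n⇒m≤1+n a≤k , e∣m , x≡p^a*e

p^a*e-injective : Prime p → ¬ p ∣ e → ¬ p ∣ f → p ^ a * e ≡ p ^ b * f → a ≡ b × e ≡ f
p^a*e-injective {a = zero} {b = zero} _ _ _ eq = refl , *-cancelˡ-≡ _ _ 1 eq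
p^a*e-injective {p = p} {e = e} {f = f} {a = zero} {b = suc b} _ p∤e _ eq =
  contradiction (subst (p ∣_) (trans (sym eq) (*-identityˡ e)) (p∣p^[1+a]*e p b f)) p∤e
p^a*e-injective {p = p} {e = e} {f = f} {a = suc a} {b = zero} _ _ p∤f eq =
  contradiction (subst (p ∣_) (trans eq (*-identityˡ f)) (p∣p^[1+a]*e p a e)) p∤f
p^a*e-injective {p = p} {e = e} {f = f} {a = suc a} {b = suc b} p-prime p∤e p∤f eq =
  let a≡b , e≡f = p^a*e-injective p-prime p∤e p∤f
        (*-cancelˡ-≡ _ _ p {{prime⇒nonZero p-prime}} (trans (sym (*-assoc p _ e)) (trans eq (*-assoc p _ f))))
  in cong suc a≡b , e≡f

-- The divisors of a factorization

ValidFactorization-head : ValidFactorization ((p , k) ∷ fs) → Prime p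
ValidFactorization-head ((p-prime , _) ∷ _ , _) = p-prime

ValidFactorization-tail : ValidFactorization ((p , k) ∷ fs) → ValidFactorization fs
ValidFactorization-tail (_ ∷ ps , _ ∷ ps!) = ps , ps!

coprime-evalFactorization : Prime p → All (λ e → Prime (proj₁ e) × 1 ≤ proj₂ e) fs →
  All (p ≢_) (map proj₁ fs) → Coprime p (evalFactorization fs)
coprime-evalFactorization {fs = []} p-prime [] [] = Coprime.sym (1-coprimeTo _)
coprime-evalFactorization {fs = (q , j) ∷ fs} p-prime ((q-prime , _) ∷ qs) (p≢q ∷ p≢qs) =
  coprime-*ʳ (coprime-^ʳ j (distinct-primes-coprime p-prime q-prime p≢q))
             (coprime-evalFactorization p-prime qs p≢qs)

ValidFactorization-∤ : ValidFactorization ((p , k) ∷ fs) → ¬ p ∣ evalFactorization fs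
ValidFactorization-∤ ((p-prime , _) ∷ ps , p≢ps ∷ _) = coprime⇒∤ p-prime (coprime-evalFactorization p-prime ps p≢ps)

evalFactorization-nonZero : ValidFactorization fs → NonZero (evalFactorization fs)
evalFactorization-nonZero (ps , _) =
  product≢0 (All-map⁺ (All.map (λ {(p , k)} (p-prime , _) → m^n≢0 p k {{prime⇒nonZero p-prime}}) ps))

scaleByPowers : ℕ → ℕ → List ℕ → List ℕ
scaleByPowers p k = cartesianProductWith (λ a e → p ^ a * e) (upTo (suc k))

divisorList : List (ℕ × ℕ) → List ℕ
divisorList []             = [ 1 ]
divisorList ((p , k) ∷ fs) = scaleByPowers p k (divisorList fs)

∈-scaleByPowers⁻ : x ∈ scaleByPowers p k L → ∃₂ λ a e → a ≤ k × e ∈ L × x ≡ p ^ a * e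
∈-scaleByPowers⁻ {p = p} {k = k} {L = L} x∈ =
  let a , e , a∈ , e∈L , x≡p^a*e = ∈-cartesianProductWith⁻ (λ a e → p ^ a * e) (upTo (suc k)) L x∈
  in a , e , s≤s⁻¹ (∈-upTo⁻ a∈) , e∈L , x≡p^a*e

∈-scaleByPowers⁺ : a ≤ k → e ∈ L → p ^ a * e ∈ scaleByPowers p k L
∈-scaleByPowers⁺ {p = p} a≤k e∈L = ∈-cartesianProductWith⁺ (λ a e → p ^ a * e) (∈-upTo⁺ (s≤s a≤k)) e∈L

divisorList-sound : x ∈ divisorList fs → x ∣ evalFactorization fs
divisorList-sound {fs = []} (here refl) = ∣-refl
divisorList-sound {fs = (p , k) ∷ fs} x∈ with ∈-scaleByPowers⁻ {p = p} {k = k} {L = divisorList fs} x∈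
... | a , e , a≤k , e∈ , refl = *-pres-∣ (^-monoʳ-∣ p a≤k) (divisorList-sound {fs = fs} e∈)

∤-divisorList : ValidFactorization ((p , k) ∷ fs) → e ∈ divisorList fs → ¬ p ∣ e
∤-divisorList {fs = fs} valid e∈ p∣e = ValidFactorization-∤ valid (∣-trans p∣e (divisorList-sound {fs = fs} e∈))

divisorList-complete : ValidFactorization fs → x ∣ evalFactorization fs → x ∈ divisorList fs
divisorList-complete {fs = []} _ x∣1 = here (∣1⇒≡1 x∣1)
divisorList-complete {fs = (p , k) ∷ fs} valid x∣
  with ∣p^k*m⇒≡p^a*e (ValidFactorization-head valid) (ValidFactorization-∤ valid) k x∣
... | a , e , a≤k , e∣ , refl = ∈-scaleByPowers⁺ a≤k (divisorList-complete (ValidFactorization-tail valid) e∣)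

divisorList-unique : ValidFactorization fs → Unique (divisorList fs)
divisorList-unique {fs = []} _ = [] ∷ []
divisorList-unique {fs = (p , k) ∷ fs} valid = unique-cartesianProductWith-local _
  (λ b∈ d∈ → p^a*e-injective (ValidFactorization-head valid) (∤-divisorList valid b∈) (∤-divisorList valid d∈))
  (Unique.upTo⁺ (suc k)) (divisorList-unique (ValidFactorization-tail valid))

∈-divisors⁻ : x ∈ divisors n → x ∣ n
∈-divisors⁻ {n = n} x∈ = proj₂ (∈-filter⁻ (_∣? n) {xs = map suc (upTo n)} x∈)

∈-divisors⁺ : .{{NonZero n}} → x ∣ n → x ∈ divisors n
∈-divisors⁺ {n} {zero} x∣n = contradiction (0∣⇒≡0 x∣n) (≢-nonZero⁻¹ n)
∈-divisors⁺ {n} {suc x} x∣n = ∈-filter⁺ (_∣? n) (∈-map⁺ suc (∈-upTo⁺ (∣⇒≤ x∣n))) x∣n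

divisors-unique : ∀ n → Unique (divisors n)
divisors-unique n = Unique.filter⁺ (_∣? n) (Unique.map⁺ suc-injective (Unique.upTo⁺ n))

∑-divisors : ValidFactorization fs → (f : ℕ → ℕ) → ∑ (divisors (evalFactorization fs)) f ≡ ∑ (divisorList fs) f
∑-divisors {fs} valid f = ∑-unique f (divisors-unique (evalFactorization fs)) (divisorList-unique valid) (mk⇔
  (divisorList-complete valid ∘ ∈-divisors⁻ {n = evalFactorization fs})
  (∈-divisors⁺ {{evalFactorization-nonZero valid}} ∘ divisorList-sound {fs = fs}))

length-cartesianProductWith : ∀ (g : A → B → C) xs ys →
  length (cartesianProductWith g xs ys) ≡ length xs * length ys
length-cartesianProductWith g [] ys = refl
length-cartesianProductWith g (x ∷ xs) ys = begin
  length (map (g x) ys ++ cartesianProductWith g xs ys)       ≡⟨ length-++ (map (g x) ys) ⟩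
  length (map (g x) ys) + length (cartesianProductWith g xs ys)
    ≡⟨ cong₂ _+_ (length-map (g x) ys) (length-cartesianProductWith g xs ys) ⟩
  length ys + length xs * length ys                          ∎

length-divisorList : ∀ fs → length (divisorList fs) ≡ prodExp suc fs
length-divisorList [] = refl
length-divisorList ((p , k) ∷ fs) = begin
  length (scaleByPowers p k (divisorList fs))
    ≡⟨ length-cartesianProductWith (λ a e → p ^ a * e) (upTo (suc k)) (divisorList fs) ⟩
  length (upTo (suc k)) * length (divisorList fs)  ≡⟨ cong₂ _*_ (length-upTo (suc k)) (length-divisorList fs) ⟩
  suc k * prodExp suc fs                           ∎

-- Multiplicativity of coprime counts

prodExp-* : ∀ (g h : ℕ → ℕ) fs → prodExp (λ k → g k * h k) fs ≡ prodExp g fs * prodExp h fs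
prodExp-* g h [] = refl
prodExp-* g h ((p , k) ∷ fs) = trans (cong (g k * h k *_) (prodExp-* g h fs))
  (interchange *-commutativeSemigroup (g k) (h k) (prodExp g fs) (prodExp h fs))

multiplicative⇒≡prodExp : ∀ (Φ : List (ℕ × ℕ) → ℕ) (g : ℕ → ℕ) → Φ [] ≡ 1 →
  (∀ {p k fs} → ValidFactorization ((p , k) ∷ fs) → Φ ((p , k) ∷ fs) ≡ g k * Φ fs) →
  ValidFactorization fs → Φ fs ≡ prodExp g fs
multiplicative⇒≡prodExp {[]} Φ g Φ[]≡1 Φ-step _ = Φ[]≡1
multiplicative⇒≡prodExp {(p , k) ∷ fs} Φ g Φ[]≡1 Φ-step valid = trans (Φ-step valid)
  (cong (g k *_) (multiplicative⇒≡prodExp Φ g Φ[]≡1 Φ-step (ValidFactorization-tail valid)))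

coprimeCount : List ℕ → ℕ → ℕ
coprimeCount L x = ∑[ y ∈ L ] 𝟙 (coprime? x y)

coprimeCount-1 : ∀ L → coprimeCount L 1 ≡ length L
coprimeCount-1 L = trans (∑-cong L (λ y → 𝟙-yes (coprime? 1 y) (1-coprimeTo y)))
                         (trans (∑-const L 1) (*-identityʳ (length L)))

coprimePowerCount : ℕ → ℕ → ℕ
coprimePowerCount k zero    = suc k
coprimePowerCount k (suc _) = 1

∑-upTo-suc : ∀ k (f : ℕ → ℕ) c → (∀ j → f (suc j) ≡ c) → ∑ (upTo (suc k)) f ≡ f 0 + k * c
∑-upTo-suc k f c f[1+j]≡c = cong (f 0 +_) (begin
  ∑ (applyUpTo suc k) f  ≡⟨ cong (λ js → ∑ js f) (sym (map-upTo suc k)) ⟩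
  ∑ (map suc (upTo k)) f ≡⟨ ∑-map suc (upTo k) f ⟩
  ∑ (upTo k) (f ∘ suc)   ≡⟨ ∑-cong (upTo k) f[1+j]≡c ⟩
  ∑[ _ ∈ upTo k ] c      ≡⟨ ∑-const (upTo k) c ⟩
  length (upTo k) * c    ≡⟨ cong (_* c) (length-upTo k) ⟩
  k * c                  ∎)

∑-powersCoprime : ∀ k a → ∑ (upTo (suc k)) (powersCoprime a) ≡ coprimePowerCount k a
∑-powersCoprime k zero    = trans (∑-upTo-suc k (powersCoprime 0) 1 (λ _ → refl)) (cong suc (*-identityʳ k))
∑-powersCoprime k (suc a) = trans (∑-upTo-suc k (powersCoprime (suc a)) 0 (λ _ → refl)) (cong suc (*-zeroʳ k))

∑-coprimePowerCount : ∀ k → ∑ (upTo (suc k)) (coprimePowerCount k) ≡ 2 * k + 1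
∑-coprimePowerCount k = trans (∑-upTo-suc k (coprimePowerCount k) 1 (λ _ → refl)) (arithmetic k)
  where
  arithmetic : ∀ k → suc k + k * 1 ≡ 2 * k + 1
  arithmetic = solve-∀

∑-coprimePowerCount² : ∀ k → ∑[ a ∈ upTo (suc k) ] coprimePowerCount k a * coprimePowerCount k a
                            ≡ suc k * suc k + k
∑-coprimePowerCount² k =
  trans (∑-upTo-suc k (λ a → coprimePowerCount k a * coprimePowerCount k a) 1 (λ _ → refl))
        (cong (suc k * suc k +_) (*-identityʳ k))

∑-coprimePowerPairs : ∀ k →
  ∑[ a ∈ upTo (suc k) ] ∑[ b ∈ upTo (suc k) ] powersCoprime a b * (coprimePowerCount k a * coprimePowerCount k b)
  ≡ suc k * (3 * k + 1)
∑-coprimePowerPairs k = begin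
  ∑[ a ∈ upTo (suc k) ] ∑[ b ∈ upTo (suc k) ] powersCoprime a b * (w a * w b)
    ≡⟨ ∑-upTo-suc k (λ a → ∑[ b ∈ upTo (suc k) ] powersCoprime a b * (w a * w b)) (1 * (1 * suc k) + k * 0)
         (λ j → ∑-upTo-suc k (λ b → powersCoprime (suc j) b * (1 * w b)) 0 (λ _ → refl)) ⟩
  (∑[ b ∈ upTo (suc k) ] 1 * (suc k * w b)) + k * (1 * (1 * suc k) + k * 0)
    ≡⟨ cong (_+ k * (1 * (1 * suc k) + k * 0)) (∑-upTo-suc k (λ b → 1 * (suc k * w b)) (1 * (suc k * 1)) (λ _ → refl)) ⟩
  1 * (suc k * suc k) + k * (1 * (suc k * 1)) + k * (1 * (1 * suc k) + k * 0)
    ≡⟨ arithmetic k ⟩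
  suc k * (3 * k + 1) ∎
  where
  w : ℕ → ℕ
  w = coprimePowerCount k
  arithmetic : ∀ k → 1 * (suc k * suc k) + k * (1 * (suc k * 1)) + k * (1 * (1 * suc k) + k * 0)
                     ≡ suc k * (3 * k + 1)
  arithmetic = solve-∀

module PrimeLayer {p} (p-prime : Prime p) (k : ℕ) {L : List ℕ} (p∤L : ∀ {e} → e ∈ L → ¬ p ∣ e) where
  private
    L′ : List ℕ
    L′ = scaleByPowers p k L
    w c c′ : ℕ → ℕ
    w  = coprimePowerCount k
    c  = coprimeCount L
    c′ = coprimeCount L′

  𝟙-coprime-scale : e ∈ L → f ∈ L →
    𝟙 (coprime? (p ^ a * e) (p ^ b * f)) ≡ powersCoprime a b * 𝟙 (coprime? e f)
  𝟙-coprime-scale {e = e} {f = f} {a = a} {b = b} e∈ f∈ = begin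
    𝟙 (coprime? (p ^ a * e) (p ^ b * f))
      ≡⟨ 𝟙-⇔ (coprime-*-⇔ (p^a⊥ a f∈) (Coprime.sym (p^a⊥ b e∈)))
             (coprime? (p ^ a * e) (p ^ b * f)) (coprime? (p ^ a) (p ^ b) ×-dec coprime? e f) ⟩
    𝟙 (coprime? (p ^ a) (p ^ b) ×-dec coprime? e f)     ≡⟨ 𝟙-×-dec (coprime? (p ^ a) (p ^ b)) (coprime? e f) ⟩
    𝟙 (coprime? (p ^ a) (p ^ b)) * 𝟙 (coprime? e f)    ≡⟨ cong (_* 𝟙 (coprime? e f)) (𝟙-coprime-^ p-prime a b) ⟩
    powersCoprime a b * 𝟙 (coprime? e f)               ∎
    where
    p^a⊥ : ∀ a {e} → e ∈ L → Coprime (p ^ a) e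
    p^a⊥ a e∈ = coprime-^ˡ a (prime∤⇒coprime p-prime (p∤L e∈))

  coprimeCount-scale : e ∈ L → c′ (p ^ a * e) ≡ w a * c e
  coprimeCount-scale {e = e} {a = a} e∈ = begin
    c′ (p ^ a * e)
      ≡⟨ ∑-cartesianProductWith-* _ (upTo (suc k)) L (powersCoprime a) (λ f → 𝟙 (coprime? e f))
           (λ b f∈ → 𝟙-coprime-scale {a = a} {b = b} e∈ f∈) ⟩
    ∑ (upTo (suc k)) (powersCoprime a) * c e ≡⟨ cong (_* c e) (∑-powersCoprime k a) ⟩
    w a * c e                               ∎

  ∑-coprimeCount : ∑ L′ c′ ≡ (2 * k + 1) * ∑ L c
  ∑-coprimeCount = begin
    ∑ L′ c′
      ≡⟨ ∑-cartesianProductWith-* _ (upTo (suc k)) L w c (λ a e∈ → coprimeCount-scale {a = a} e∈) ⟩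
    ∑ (upTo (suc k)) w * ∑ L c ≡⟨ cong (_* ∑ L c) (∑-coprimePowerCount k) ⟩
    (2 * k + 1) * ∑ L c        ∎

  ∑-coprimeCount² : ∑[ x ∈ L′ ] c′ x * c′ x ≡ (suc k * suc k + k) * (∑[ x ∈ L ] c x * c x)
  ∑-coprimeCount² = begin
    ∑[ x ∈ L′ ] c′ x * c′ x
      ≡⟨ ∑-cartesianProductWith-* _ (upTo (suc k)) L (λ a → w a * w a) (λ e → c e * c e) (λ a {e} e∈ →
           trans (cong₂ _*_ (coprimeCount-scale {a = a} e∈) (coprimeCount-scale {a = a} e∈))
                 (interchange *-commutativeSemigroup (w a) (c e) (w a) (c e))) ⟩
    (∑[ a ∈ upTo (suc k) ] w a * w a) * (∑[ x ∈ L ] c x * c x)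
      ≡⟨ cong (_* (∑[ x ∈ L ] c x * c x)) (∑-coprimePowerCount² k) ⟩
    (suc k * suc k + k) * (∑[ x ∈ L ] c x * c x) ∎

  ∑-coprimePairs : ∑[ x ∈ L′ ] ∑[ y ∈ L′ ] 𝟙 (coprime? x y) * (c′ x * c′ y)
                 ≡ suc k * (3 * k + 1) * (∑[ x ∈ L ] ∑[ y ∈ L ] 𝟙 (coprime? x y) * (c x * c y))
  ∑-coprimePairs = begin
    ∑[ x ∈ L′ ] ∑[ y ∈ L′ ] 𝟙 (coprime? x y) * (c′ x * c′ y)
      ≡⟨ ∑-cartesianProductWith-* _ (upTo (suc k)) L α β (λ a {e} e∈ →
           ∑-cartesianProductWith-* _ (upTo (suc k)) L (λ b → powersCoprime a b * (w a * w b))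
             (λ f → 𝟙 (coprime? e f) * (c e * c f)) (λ b f∈ → pairTerm {a = a} {b = b} e∈ f∈)) ⟩
    (∑[ a ∈ upTo (suc k) ] ∑[ b ∈ upTo (suc k) ] powersCoprime a b * (w a * w b))
      * (∑[ x ∈ L ] ∑[ y ∈ L ] 𝟙 (coprime? x y) * (c x * c y))
      ≡⟨ cong (_* (∑[ x ∈ L ] ∑[ y ∈ L ] 𝟙 (coprime? x y) * (c x * c y))) (∑-coprimePowerPairs k) ⟩
    suc k * (3 * k + 1) * (∑[ x ∈ L ] ∑[ y ∈ L ] 𝟙 (coprime? x y) * (c x * c y)) ∎
    where
    α β : ℕ → ℕ
    α = λ a → ∑[ b ∈ upTo (suc k) ] powersCoprime a b * (w a * w b)
    β = λ e → ∑[ f ∈ L ] 𝟙 (coprime? e f) * (c e * c f)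
    regroup : ∀ z t wa ce wb cf → z * t * (wa * ce * (wb * cf)) ≡ z * (wa * wb) * (t * (ce * cf))
    regroup = solve-∀
    pairTerm : e ∈ L → f ∈ L → 𝟙 (coprime? (p ^ a * e) (p ^ b * f)) * (c′ (p ^ a * e) * c′ (p ^ b * f))
             ≡ powersCoprime a b * (w a * w b) * (𝟙 (coprime? e f) * (c e * c f))
    pairTerm {e = e} {f = f} {a = a} {b = b} e∈ f∈ =
      trans (cong₂ _*_ (𝟙-coprime-scale {a = a} {b = b} e∈ f∈)
                       (cong₂ _*_ (coprimeCount-scale {a = a} e∈) (coprimeCount-scale {a = b} f∈)))
            (regroup (powersCoprime a b) (𝟙 (coprime? e f)) (w a) (c e) (w b) (c f))

∑-coprimeCount-divisorList : ValidFactorization fs →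
  ∑ (divisorList fs) (coprimeCount (divisorList fs)) ≡ prodExp (λ k → 2 * k + 1) fs
∑-coprimeCount-divisorList = multiplicative⇒≡prodExp
  (λ fs → ∑ (divisorList fs) (coprimeCount (divisorList fs))) (λ k → 2 * k + 1) refl
  (λ {k = k} valid → PrimeLayer.∑-coprimeCount (ValidFactorization-head valid) k (∤-divisorList valid))

∑-coprimeCount²-divisorList : ValidFactorization fs →
  ∑[ x ∈ divisorList fs ] coprimeCount (divisorList fs) x * coprimeCount (divisorList fs) x
  ≡ prodExp (λ k → suc k * suc k + k) fs
∑-coprimeCount²-divisorList = multiplicative⇒≡prodExp
  (λ fs → ∑[ x ∈ divisorList fs ] coprimeCount (divisorList fs) x * coprimeCount (divisorList fs) x)
  (λ k → suc k * suc k + k) refl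
  (λ {k = k} valid → PrimeLayer.∑-coprimeCount² (ValidFactorization-head valid) k (∤-divisorList valid))

∑-coprimePairs-divisorList : ValidFactorization fs →
  ∑[ x ∈ divisorList fs ] ∑[ y ∈ divisorList fs ]
    𝟙 (coprime? x y) * (coprimeCount (divisorList fs) x * coprimeCount (divisorList fs) y)
  ≡ prodExp suc fs * prodExp (λ k → 3 * k + 1) fs
∑-coprimePairs-divisorList {fs} valid = trans
  (multiplicative⇒≡prodExp
    (λ fs → ∑[ x ∈ divisorList fs ] ∑[ y ∈ divisorList fs ]
              𝟙 (coprime? x y) * (coprimeCount (divisorList fs) x * coprimeCount (divisorList fs) y))
    (λ k → suc k * (3 * k + 1)) refl
    (λ {k = k} valid → PrimeLayer.∑-coprimePairs (ValidFactorization-head valid) k (∤-divisorList valid))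
    valid)
  (prodExp-* suc (λ k → 3 * k + 1) fs)

-- Degrees versus coprime counts

δ₁ : ℕ → ℕ
δ₁ x = 𝟙 (x ≟ 1)

degreeIn : List ℕ → ℕ → ℕ
degreeIn V x = ∑[ y ∈ V ] 𝟙 (adj? x y)

δ₁-distinct : x ≢ y → δ₁ x * δ₁ y ≡ 0
δ₁-distinct {x} {y} x≢y with x ≟ 1
... | yes refl = trans (cong (δ₁ 1 *_) (𝟙-no (y ≟ 1) (x≢y ∘ sym))) (*-zeroʳ (δ₁ 1))
... | no x≢1   = cong (_* δ₁ y) (𝟙-no (x ≟ 1) x≢1)

𝟙-adj-sym : ∀ x y → 𝟙 (adj? x y) ≡ 𝟙 (adj? y x)
𝟙-adj-sym x y = 𝟙-⇔ (mk⇔ Adj-sym Adj-sym) (adj? x y) (adj? y x)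
  where
  Adj-sym : ∀ {x y} → Adj x y → Adj y x
  Adj-sym {x} {y} (x≢y , gcd≡1) = x≢y ∘ sym , trans (gcd-comm y x) gcd≡1

𝟙-adj-self : ∀ x → 𝟙 (adj? x x) ≡ 0
𝟙-adj-self x = 𝟙-no (adj? x x) (λ (x≢x , _) → x≢x refl)

-- A direct `with x ≟ y` (or `<-cmp x y`) in a goal mentioning adj? x y or coprime? x y would also
-- abstract the copies hidden inside gcd x y, so such case splits go through an abstract relation R.
≡-cases : (R : ℕ → ℕ → Set) → (∀ x → R x x) → (∀ {x y} → x ≢ y → R x y) → ∀ x y → R x y
≡-cases R diagonal offDiagonal x y with x ≟ y
... | yes refl = diagonal x
... | no x≢y   = offDiagonal x≢y

𝟙-coprime-split : ∀ x y → 𝟙 (coprime? x y) ≡ 𝟙 (adj? x y) + δ₁ x * δ₁ y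
𝟙-coprime-split = ≡-cases (λ x y → 𝟙 (coprime? x y) ≡ 𝟙 (adj? x y) + δ₁ x * δ₁ y) diagonal offDiagonal
  where
  diagonal : ∀ x → 𝟙 (coprime? x x) ≡ 𝟙 (adj? x x) + δ₁ x * δ₁ x
  diagonal x = begin
    𝟙 (coprime? x x)
      ≡⟨ 𝟙-⇔ (mk⇔ (λ (x⊥x : Coprime x x) → x⊥x (∣-refl , ∣-refl)) λ { refl → 1-coprimeTo 1 })
             (coprime? x x) (x ≟ 1) ⟩
    δ₁ x                       ≡⟨ 𝟙-idem (x ≟ 1) ⟨
    δ₁ x * δ₁ x                ≡⟨ cong (_+ δ₁ x * δ₁ x) (𝟙-adj-self x) ⟨
    𝟙 (adj? x x) + δ₁ x * δ₁ x ∎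
  offDiagonal : x ≢ y → 𝟙 (coprime? x y) ≡ 𝟙 (adj? x y) + δ₁ x * δ₁ y
  offDiagonal {x} {y} x≢y = begin
    𝟙 (coprime? x y)
      ≡⟨ 𝟙-⇔ (mk⇔ (λ (x⊥y : Coprime x y) → x≢y , coprime⇒gcd≡1 x⊥y) (gcd≡1⇒coprime ∘ proj₂))
             (coprime? x y) (adj? x y) ⟩
    𝟙 (adj? x y)               ≡⟨ +-identityʳ (𝟙 (adj? x y)) ⟨
    𝟙 (adj? x y) + 0           ≡⟨ cong (𝟙 (adj? x y) +_) (δ₁-distinct x≢y) ⟨
    𝟙 (adj? x y) + δ₁ x * δ₁ y ∎

𝟙-adj-δ₁-δ₁ : ∀ x y → 𝟙 (adj? x y) * (δ₁ x * δ₁ y) ≡ 0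
𝟙-adj-δ₁-δ₁ = ≡-cases (λ x y → 𝟙 (adj? x y) * (δ₁ x * δ₁ y) ≡ 0)
  (λ x → cong (_* (δ₁ x * δ₁ x)) (𝟙-adj-self x))
  (λ {x} {y} x≢y → trans (cong (𝟙 (adj? x y) *_) (δ₁-distinct x≢y)) (*-zeroʳ (𝟙 (adj? x y))))

𝟙-adj-1 : ∀ x → 𝟙 (adj? x 1) + δ₁ x ≡ 1
𝟙-adj-1 x = begin
  𝟙 (adj? x 1) + δ₁ x      ≡⟨ cong (𝟙 (adj? x 1) +_) (*-identityʳ (δ₁ x)) ⟨
  𝟙 (adj? x 1) + δ₁ x * 1  ≡⟨ 𝟙-coprime-split x 1 ⟨
  𝟙 (coprime? x 1)         ≡⟨ 𝟙-yes (coprime? x 1) (Coprime.sym (1-coprimeTo x)) ⟩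
  1                        ∎

module DegreeSums {V : List ℕ} (V! : Unique V) (1∈V : 1 ∈ V) where
  private
    c d : ℕ → ℕ
    c = coprimeCount V
    d = degreeIn V

    adj : ℕ → ℕ → ℕ
    adj x y = 𝟙 (adj? x y)

    adjacentPairSum coprimePairSum neighboursOf1-degreeSum : ℕ
    adjacentPairSum         = ∑[ x ∈ V ] ∑[ y ∈ V ] adj x y * (d x * d y)
    coprimePairSum          = ∑[ x ∈ V ] ∑[ y ∈ V ] 𝟙 (coprime? x y) * (c x * c y)
    neighboursOf1-degreeSum = ∑[ x ∈ V ] adj x 1 * d x

  ∑-δ₁ : ∀ g → ∑[ x ∈ V ] δ₁ x * g x ≡ g 1
  ∑-δ₁ g = ∑-𝟙≡ g V! 1∈V

  ∑∑-δ₁ : ∀ (F : ℕ → ℕ → ℕ) → ∑[ x ∈ V ] ∑[ y ∈ V ] δ₁ x * δ₁ y * F x y ≡ F 1 1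
  ∑∑-δ₁ F = begin
    ∑[ x ∈ V ] ∑[ y ∈ V ] δ₁ x * δ₁ y * F x y
      ≡⟨ ∑-cong V (λ x → ∑-cong V (λ y → *-assoc (δ₁ x) (δ₁ y) (F x y))) ⟩
    ∑[ x ∈ V ] ∑[ y ∈ V ] δ₁ x * (δ₁ y * F x y)
      ≡⟨ ∑-cong V (λ x → ∑-*ˡ V (δ₁ x) (λ y → δ₁ y * F x y)) ⟩
    ∑[ x ∈ V ] δ₁ x * (∑[ y ∈ V ] δ₁ y * F x y) ≡⟨ ∑-cong V (λ x → cong (δ₁ x *_) (∑-δ₁ (F x))) ⟩
    ∑[ x ∈ V ] δ₁ x * F x 1                     ≡⟨ ∑-δ₁ (λ x → F x 1) ⟩
    F 1 1                                       ∎

  coprimeCount≡degree+δ₁ : ∀ x → c x ≡ d x + δ₁ x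
  coprimeCount≡degree+δ₁ x = begin
    c x                                  ≡⟨ ∑-cong V (𝟙-coprime-split x) ⟩
    ∑[ y ∈ V ] (adj x y + δ₁ x * δ₁ y)   ≡⟨ ∑-+ V (adj x) (λ y → δ₁ x * δ₁ y) ⟩
    d x + (∑[ y ∈ V ] δ₁ x * δ₁ y)       ≡⟨ cong (d x +_) (∑-cong V (λ y → *-comm (δ₁ x) (δ₁ y))) ⟩
    d x + (∑[ y ∈ V ] δ₁ y * δ₁ x)       ≡⟨ cong (d x +_) (∑-δ₁ (λ _ → δ₁ x)) ⟩
    d x + δ₁ x                           ∎

  ∑-coprimeCount : ∑ V d + 1 ≡ ∑ V c
  ∑-coprimeCount = begin
    ∑ V d + 1
      ≡⟨ cong (∑ V d +_) (trans (∑-cong V (sym ∘ *-identityʳ ∘ δ₁)) (∑-δ₁ (λ _ → 1))) ⟨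
    ∑ V d + ∑ V δ₁           ≡⟨ ∑-+ V d δ₁ ⟨
    ∑[ x ∈ V ] (d x + δ₁ x)  ≡⟨ ∑-cong V coprimeCount≡degree+δ₁ ⟨
    ∑ V c                    ∎

  ∑-degree² : (∑[ x ∈ V ] d x * d x) + 2 * c 1 ≡ (∑[ x ∈ V ] c x * c x) + 1
  ∑-degree² = begin
    D² + 2 * c 1                                   ≡⟨ cong (λ t → D² + 2 * t) (coprimeCount≡degree+δ₁ 1) ⟩
    D² + 2 * (d 1 + 1)                             ≡⟨ arithmetic D² (d 1) ⟩
    D² + (2 * d 1 + 1) + 1                         ≡⟨ cong (λ t → D² + t + 1) (∑-δ₁ (λ x → 2 * d x + δ₁ x)) ⟨
    D² + (∑[ x ∈ V ] δ₁ x * (2 * d x + δ₁ x)) + 1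
      ≡⟨ cong (_+ 1) (∑-+ V (λ x → d x * d x) (λ x → δ₁ x * (2 * d x + δ₁ x))) ⟨
    (∑[ x ∈ V ] (d x * d x + δ₁ x * (2 * d x + δ₁ x))) + 1
      ≡⟨ cong (_+ 1) (∑-cong V (λ x → trans (square (d x) (δ₁ x))
                                            (sym (cong₂ _*_ (coprimeCount≡degree+δ₁ x) (coprimeCount≡degree+δ₁ x))))) ⟩
    (∑[ x ∈ V ] c x * c x) + 1                     ∎
    where
    D² : ℕ
    D² = ∑[ x ∈ V ] d x * d x
    arithmetic : ∀ s d₁ → s + 2 * (d₁ + 1) ≡ s + (2 * d₁ + 1) + 1
    arithmetic = solve-∀
    square : ∀ d i → d * d + i * (2 * d + i) ≡ (d + i) * (d + i)
    square = solve-∀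

  neighboursOf1-degreeSum+degree1 : neighboursOf1-degreeSum + d 1 ≡ ∑ V d
  neighboursOf1-degreeSum+degree1 = begin
    neighboursOf1-degreeSum + d 1                    ≡⟨ cong (neighboursOf1-degreeSum +_) (∑-δ₁ d) ⟨
    neighboursOf1-degreeSum + (∑[ x ∈ V ] δ₁ x * d x) ≡⟨ ∑-+ V (λ x → adj x 1 * d x) (λ x → δ₁ x * d x) ⟨
    ∑[ x ∈ V ] (adj x 1 * d x + δ₁ x * d x)          ≡⟨ ∑-cong V (λ x → *-distribʳ-+ (d x) (adj x 1) (δ₁ x)) ⟨
    ∑[ x ∈ V ] (adj x 1 + δ₁ x) * d x
      ≡⟨ ∑-cong V (λ x → trans (cong (_* d x) (𝟙-adj-1 x)) (*-identityˡ (d x))) ⟩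
    ∑ V d                                            ∎

  ∑-adjacentPairs-coprimeCount :
    ∑[ x ∈ V ] ∑[ y ∈ V ] adj x y * (c x * c y) ≡ adjacentPairSum + neighboursOf1-degreeSum + neighboursOf1-degreeSum
  ∑-adjacentPairs-coprimeCount = begin
    ∑[ x ∈ V ] ∑[ y ∈ V ] adj x y * (c x * c y)
      ≡⟨ ∑-cong V (λ x → ∑-cong V (expand x)) ⟩
    ∑[ x ∈ V ] ∑[ y ∈ V ] (adj x y * (d x * d y) + δ₁ y * (adj x y * d x) + δ₁ x * (adj x y * d y))
      ≡⟨ ∑∑-+ V V (λ x y → adj x y * (d x * d y) + δ₁ y * (adj x y * d x)) (λ x y → δ₁ x * (adj x y * d y)) ⟩
    (∑[ x ∈ V ] ∑[ y ∈ V ] (adj x y * (d x * d y) + δ₁ y * (adj x y * d x)))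
      + (∑[ x ∈ V ] ∑[ y ∈ V ] δ₁ x * (adj x y * d y))
      ≡⟨ cong₂ _+_ (∑∑-+ V V (λ x y → adj x y * (d x * d y)) (λ x y → δ₁ y * (adj x y * d x))) rowOf1 ⟩
    adjacentPairSum + (∑[ x ∈ V ] ∑[ y ∈ V ] δ₁ y * (adj x y * d x)) + neighboursOf1-degreeSum
      ≡⟨ cong (λ t → adjacentPairSum + t + neighboursOf1-degreeSum)
              (∑-cong V (λ x → ∑-δ₁ (λ y → adj x y * d x))) ⟩
    adjacentPairSum + neighboursOf1-degreeSum + neighboursOf1-degreeSum ∎
    where
    ring : ∀ a dx dy ix iy → a * ((dx + ix) * (dy + iy))
                           ≡ a * (dx * dy) + iy * (a * dx) + ix * (a * dy) + a * (ix * iy)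
    ring = solve-∀
    expand : ∀ x y → adj x y * (c x * c y) ≡ adj x y * (d x * d y) + δ₁ y * (adj x y * d x) + δ₁ x * (adj x y * d y)
    expand x y = begin
      adj x y * (c x * c y)
        ≡⟨ cong₂ (λ s t → adj x y * (s * t)) (coprimeCount≡degree+δ₁ x) (coprimeCount≡degree+δ₁ y) ⟩
      adj x y * ((d x + δ₁ x) * (d y + δ₁ y))
        ≡⟨ ring (adj x y) (d x) (d y) (δ₁ x) (δ₁ y) ⟩
      adj x y * (d x * d y) + δ₁ y * (adj x y * d x) + δ₁ x * (adj x y * d y) + adj x y * (δ₁ x * δ₁ y)
        ≡⟨ trans (cong₂ _+_ refl (𝟙-adj-δ₁-δ₁ x y)) (+-identityʳ _) ⟩
      adj x y * (d x * d y) + δ₁ y * (adj x y * d x) + δ₁ x * (adj x y * d y) ∎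
    rowOf1 : ∑[ x ∈ V ] ∑[ y ∈ V ] δ₁ x * (adj x y * d y) ≡ neighboursOf1-degreeSum
    rowOf1 = begin
      ∑[ x ∈ V ] ∑[ y ∈ V ] δ₁ x * (adj x y * d y)
        ≡⟨ ∑-cong V (λ x → ∑-*ˡ V (δ₁ x) (λ y → adj x y * d y)) ⟩
      ∑[ x ∈ V ] δ₁ x * (∑[ y ∈ V ] adj x y * d y) ≡⟨ ∑-δ₁ (λ x → ∑[ y ∈ V ] adj x y * d y) ⟩
      ∑[ y ∈ V ] adj 1 y * d y                     ≡⟨ ∑-cong V (λ y → cong (_* d y) (𝟙-adj-sym 1 y)) ⟩
      neighboursOf1-degreeSum                      ∎

  coprimePairSum≡ : coprimePairSum ≡ adjacentPairSum + neighboursOf1-degreeSum + neighboursOf1-degreeSum + c 1 * c 1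
  coprimePairSum≡ = begin
    coprimePairSum
      ≡⟨ ∑-cong V (λ x → ∑-cong V (λ y → trans (cong (_* (c x * c y)) (𝟙-coprime-split x y))
                                               (*-distribʳ-+ (c x * c y) (adj x y) (δ₁ x * δ₁ y)))) ⟩
    ∑[ x ∈ V ] ∑[ y ∈ V ] (adj x y * (c x * c y) + δ₁ x * δ₁ y * (c x * c y))
      ≡⟨ ∑∑-+ V V (λ x y → adj x y * (c x * c y)) (λ x y → δ₁ x * δ₁ y * (c x * c y)) ⟩
    (∑[ x ∈ V ] ∑[ y ∈ V ] adj x y * (c x * c y)) + (∑[ x ∈ V ] ∑[ y ∈ V ] δ₁ x * δ₁ y * (c x * c y))
      ≡⟨ cong₂ _+_ ∑-adjacentPairs-coprimeCount (∑∑-δ₁ (λ x y → c x * c y)) ⟩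
    adjacentPairSum + neighboursOf1-degreeSum + neighboursOf1-degreeSum + c 1 * c 1 ∎

  ∑-adjacentPairs : adjacentPairSum + 2 * ∑ V c + c 1 * c 1 ≡ coprimePairSum + 2 * c 1
  ∑-adjacentPairs = rearrange coprimePairSum≡ neighboursOf1-degreeSum+degree1 ∑-coprimeCount
                              (sym (coprimeCount≡degree+δ₁ 1))
    where
    identity : ∀ E R d₁ → E + 2 * (R + d₁ + 1) + (d₁ + 1) * (d₁ + 1)
                        ≡ E + R + R + (d₁ + 1) * (d₁ + 1) + 2 * (d₁ + 1)
    identity = solve-∀
    rearrange : ∀ {E R d₁ Sd Sc c₁ T} → T ≡ E + R + R + c₁ * c₁ → R + d₁ ≡ Sd → Sd + 1 ≡ Sc → d₁ + 1 ≡ c₁ →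
                E + 2 * Sc + c₁ * c₁ ≡ T + 2 * c₁
    rearrange {E} {R} {d₁} refl refl refl refl = identity E R d₁

-- Zagreb indices

<-cases : (R : ℕ → ℕ → Set) → (∀ {x y} → x < y → R x y) → (∀ x → R x x) → (∀ {x y} → y < x → R x y) →
  ∀ x y → R x y
<-cases R below diagonal above x y with <-cmp x y
... | tri< x<y _ _  = below x<y
... | tri≈ _ refl _ = diagonal x
... | tri> _ _ y<x  = above y<x

𝟙-ordered-adj : ∀ x y → 𝟙 ((x <? y) ×-dec adj? x y) + 𝟙 ((y <? x) ×-dec adj? y x) ≡ 𝟙 (adj? x y)
𝟙-ordered-adj = <-cases (λ x y → 𝟙 ((x <? y) ×-dec adj? x y) + 𝟙 ((y <? x) ×-dec adj? y x) ≡ 𝟙 (adj? x y))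
  (λ {x} {y} x<y → trans (split x y (𝟙-yes (x <? y) x<y) (𝟙-no (y <? x) (<-asym x<y)))
                         (trans (+-identityʳ _) (*-identityˡ _)))
  (λ x → trans (split x x (𝟙-no (x <? x) (<-irrefl refl)) (𝟙-no (x <? x) (<-irrefl refl))) (sym (𝟙-adj-self x)))
  (λ {x} {y} y<x → trans (split x y (𝟙-no (x <? y) (<-asym y<x)) (𝟙-yes (y <? x) y<x))
                         (trans (*-identityˡ _) (𝟙-adj-sym y x)))
  where
  split : ∀ x y {i j} → 𝟙 (x <? y) ≡ i → 𝟙 (y <? x) ≡ j →
    𝟙 ((x <? y) ×-dec adj? x y) + 𝟙 ((y <? x) ×-dec adj? y x) ≡ i * 𝟙 (adj? x y) + j * 𝟙 (adj? y x)
  split x y refl refl = cong₂ _+_ (𝟙-×-dec (x <? y) (adj? x y)) (𝟙-×-dec (y <? x) (adj? y x))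

∑-orderedPairs : ∀ xs (F : ℕ → ℕ → ℕ) → (∀ x y → F x y ≡ F y x) →
  2 * (∑[ x ∈ xs ] ∑[ y ∈ xs ] 𝟙 ((x <? y) ×-dec adj? x y) * F x y)
  ≡ ∑[ x ∈ xs ] ∑[ y ∈ xs ] 𝟙 (adj? x y) * F x y
∑-orderedPairs xs F F-sym = begin
  2 * H                                       ≡⟨ cong (H +_) (+-identityʳ H) ⟩
  H + H                                       ≡⟨ cong (H +_) (∑-swap xs xs G) ⟩
  H + (∑[ x ∈ xs ] ∑[ y ∈ xs ] G y x)          ≡⟨ ∑∑-+ xs xs G (λ x y → G y x) ⟨
  ∑[ x ∈ xs ] ∑[ y ∈ xs ] (G x y + G y x)      ≡⟨ ∑-cong xs (λ x → ∑-cong xs (symmetrize x)) ⟩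
  ∑[ x ∈ xs ] ∑[ y ∈ xs ] 𝟙 (adj? x y) * F x y ∎
  where
  G : ℕ → ℕ → ℕ
  G x y = 𝟙 ((x <? y) ×-dec adj? x y) * F x y
  H : ℕ
  H = ∑[ x ∈ xs ] ∑[ y ∈ xs ] G x y
  symmetrize : ∀ x y → G x y + G y x ≡ 𝟙 (adj? x y) * F x y
  symmetrize x y = begin
    G x y + G y x
      ≡⟨ cong (G x y +_) (cong (𝟙 ((y <? x) ×-dec adj? y x) *_) (F-sym y x)) ⟩
    𝟙 ((x <? y) ×-dec adj? x y) * F x y + 𝟙 ((y <? x) ×-dec adj? y x) * F x y
      ≡⟨ *-distribʳ-+ (F x y) (𝟙 ((x <? y) ×-dec adj? x y)) _ ⟨
    (𝟙 ((x <? y) ×-dec adj? x y) + 𝟙 ((y <? x) ×-dec adj? y x)) * F x y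
      ≡⟨ cong (_* F x y) (𝟙-ordered-adj x y) ⟩
    𝟙 (adj? x y) * F x y ∎

M₂≡∑orderedAdjacentPairs : ∀ n →
  M₂ n ≡ ∑[ x ∈ divisors n ] ∑[ y ∈ divisors n ] 𝟙 ((x <? y) ×-dec adj? x y) * (degree n x * degree n y)
M₂≡∑orderedAdjacentPairs n = begin
  M₂ n
    ≡⟨ ∑-concatMap (λ x → map (λ y → (x , y)) (filter (isEdge x) (divisors n))) (divisors n) degreeProduct ⟩
  ∑[ x ∈ divisors n ] ∑ (map (λ y → (x , y)) (filter (isEdge x) (divisors n))) degreeProduct
    ≡⟨ ∑-cong (divisors n) (λ x → ∑-map (λ y → (x , y)) (filter (isEdge x) (divisors n)) degreeProduct) ⟩
  ∑[ x ∈ divisors n ] ∑[ y ∈ filter (isEdge x) (divisors n) ] degree n x * degree n y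
    ≡⟨ ∑-cong (divisors n) (λ x → ∑-filter (isEdge x) (divisors n) (λ y → degree n x * degree n y)) ⟩
  ∑[ x ∈ divisors n ] ∑[ y ∈ divisors n ] 𝟙 (isEdge x y) * (degree n x * degree n y) ∎
  where
  isEdge : ∀ x y → Dec (x < y × Adj x y)
  isEdge x y = (x <? y) ×-dec adj? x y
  degreeProduct : ℕ × ℕ → ℕ
  degreeProduct (x , y) = degree n x * degree n y

module _ {fs} (valid : ValidFactorization fs) where
  private
    V Div : List ℕ
    V   = divisorList fs
    Div = divisors (evalFactorization fs)
    deg : ℕ → ℕ
    deg = degree (evalFactorization fs)

  degree≡degreeIn : ∀ x → deg x ≡ degreeIn V x
  degree≡degreeIn x = trans (length-filter (adj? x) Div) (∑-divisors valid (λ y → 𝟙 (adj? x y)))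

  M₁≡∑degree² : M₁ (evalFactorization fs) ≡ ∑[ x ∈ V ] degreeIn V x * degreeIn V x
  M₁≡∑degree² = trans (∑-divisors valid (λ x → deg x * deg x))
                      (∑-cong V (λ x → cong₂ _*_ (degree≡degreeIn x) (degree≡degreeIn x)))

  2M₂≡∑adjacentPairs :
    2 * M₂ (evalFactorization fs) ≡ ∑[ x ∈ V ] ∑[ y ∈ V ] 𝟙 (adj? x y) * (degreeIn V x * degreeIn V y)
  2M₂≡∑adjacentPairs = begin
    2 * M₂ (evalFactorization fs)
      ≡⟨ cong (2 *_) (M₂≡∑orderedAdjacentPairs (evalFactorization fs)) ⟩
    2 * (∑[ x ∈ Div ] ∑[ y ∈ Div ] 𝟙 ((x <? y) ×-dec adj? x y) * (deg x * deg y))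
      ≡⟨ ∑-orderedPairs Div (λ x y → deg x * deg y) (λ x y → *-comm (deg x) (deg y)) ⟩
    ∑[ x ∈ Div ] ∑[ y ∈ Div ] 𝟙 (adj? x y) * (deg x * deg y)
      ≡⟨ ∑-divisors valid (λ x → ∑[ y ∈ Div ] 𝟙 (adj? x y) * (deg x * deg y)) ⟩
    ∑[ x ∈ V ] ∑[ y ∈ Div ] 𝟙 (adj? x y) * (deg x * deg y)
      ≡⟨ ∑-cong V (λ x → ∑-divisors valid (λ y → 𝟙 (adj? x y) * (deg x * deg y))) ⟩
    ∑[ x ∈ V ] ∑[ y ∈ V ] 𝟙 (adj? x y) * (deg x * deg y)
      ≡⟨ ∑-cong V (λ x → ∑-cong V (λ y →
           cong (𝟙 (adj? x y) *_) (cong₂ _*_ (degree≡degreeIn x) (degree≡degreeIn y)))) ⟩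
    ∑[ x ∈ V ] ∑[ y ∈ V ] 𝟙 (adj? x y) * (degreeIn V x * degreeIn V y) ∎

  private
    1∈V : 1 ∈ V
    1∈V = divisorList-complete valid (1∣ evalFactorization fs)

    coprimeCount-1≡D : coprimeCount V 1 ≡ prodExp suc fs
    coprimeCount-1≡D = trans (coprimeCount-1 V) (length-divisorList fs)

    module Sums = DegreeSums (divisorList-unique valid) 1∈V

  M₁-identity : M₁ (evalFactorization fs) + 2 * prodExp suc fs ≡ prodExp (λ k → suc k * suc k + k) fs + 1
  M₁-identity = begin
    M₁ (evalFactorization fs) + 2 * prodExp suc fs
      ≡⟨ cong₂ _+_ M₁≡∑degree² (cong (2 *_) (sym coprimeCount-1≡D)) ⟩
    (∑[ x ∈ V ] degreeIn V x * degreeIn V x) + 2 * coprimeCount V 1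
      ≡⟨ Sums.∑-degree² ⟩
    (∑[ x ∈ V ] coprimeCount V x * coprimeCount V x) + 1
      ≡⟨ cong (_+ 1) (∑-coprimeCount²-divisorList valid) ⟩
    prodExp (λ k → suc k * suc k + k) fs + 1 ∎

  M₂-identity : 2 * M₂ (evalFactorization fs) + 2 * prodExp (λ k → 2 * k + 1) fs + prodExp suc fs * prodExp suc fs
              ≡ prodExp suc fs * prodExp (λ k → 3 * k + 1) fs + 2 * prodExp suc fs
  M₂-identity = begin
    2 * M₂ (evalFactorization fs) + 2 * prodExp (λ k → 2 * k + 1) fs + prodExp suc fs * prodExp suc fs
      ≡⟨ cong₂ _+_ (cong₂ _+_ 2M₂≡∑adjacentPairs (cong (2 *_) (sym (∑-coprimeCount-divisorList valid))))
                   (sym (cong₂ _*_ coprimeCount-1≡D coprimeCount-1≡D)) ⟩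
    (∑[ x ∈ V ] ∑[ y ∈ V ] 𝟙 (adj? x y) * (degreeIn V x * degreeIn V y))
      + 2 * ∑ V (coprimeCount V) + coprimeCount V 1 * coprimeCount V 1
      ≡⟨ Sums.∑-adjacentPairs ⟩
    (∑[ x ∈ V ] ∑[ y ∈ V ] 𝟙 (coprime? x y) * (coprimeCount V x * coprimeCount V y)) + 2 * coprimeCount V 1
      ≡⟨ cong₂ _+_ (∑-coprimePairs-divisorList valid) (cong (2 *_) coprimeCount-1≡D) ⟩
    prodExp suc fs * prodExp (λ k → 3 * k + 1) fs + 2 * prodExp suc fs ∎

-- Imported only now: its prefix +_ makes sections such as (m +_) above ambiguous.
open import Data.Integer using (+_; _-_) renaming (_+_ to _+ℤ_)
import Data.Integer.Properties as ℤ
import Data.Integer.Tactic.RingSolver as ℤ-Solver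

a+b≡c+e⇒a≡c-b+e : ∀ {a b c e} → a + b ≡ c + e → + a ≡ (+ c - + b) +ℤ + e
a+b≡c+e⇒a≡c-b+e {a} {b} {c} {e} a+b≡c+e = begin
  + a                 ≡⟨ cancel (+ a) (+ b) ⟩
  (+ a +ℤ + b) - + b  ≡⟨ cong (_- + b) (ℤ.pos-+ a b) ⟨
  + (a + b) - + b     ≡⟨ cong (λ t → + t - + b) a+b≡c+e ⟩
  + (c + e) - + b     ≡⟨ cong (_- + b) (ℤ.pos-+ c e) ⟩
  (+ c +ℤ + e) - + b  ≡⟨ reorder (+ c) (+ e) (+ b) ⟩
  (+ c - + b) +ℤ + e  ∎
  where
  cancel : ∀ x y → x ≡ (x +ℤ y) - y
  cancel = ℤ-Solver.solve-∀
  reorder : ∀ x y z → (x +ℤ y) - z ≡ (x - z) +ℤ y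
  reorder = ℤ-Solver.solve-∀

a+b+c≡d+e⇒a≡d-b-c+e : ∀ {a b c d e} → a + b + c ≡ d + e → + a ≡ ((+ d - + b) - + c) +ℤ + e
a+b+c≡d+e⇒a≡d-b-c+e {a} {b} {c} {d} {e} a+b+c≡d+e =
  trans (a+b≡c+e⇒a≡c-b+e (trans (sym (+-assoc a b c)) a+b+c≡d+e))
        (trans (cong (λ t → (+ d - t) +ℤ + e) (ℤ.pos-+ b c)) (reorder (+ d) (+ b) (+ c) (+ e)))
  where
  reorder : ∀ w x y z → (w - (x +ℤ y)) +ℤ z ≡ ((w - x) - y) +ℤ z
  reorder = ℤ-Solver.solve-∀

theorem3p4 : (n : ℕ) (fs : List (ℕ × ℕ)) → ValidFactorization fs → n ≡ evalFactorization fs →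
    (+ (M₁ n) ≡ (+ (prodExp (λ k → suc k * suc k + k) fs) - + (2 * prodExp suc fs)) +ℤ + 1)
  × (+ (2 * M₂ n) ≡ (((+ (prodExp suc fs * prodExp (λ k → 3 * k + 1) fs))
                     - + (2 * prodExp (λ k → 2 * k + 1) fs))
                     - + (prodExp suc fs * prodExp suc fs))
                     +ℤ + (2 * prodExp suc fs))
theorem3p4 .(evalFactorization fs) fs valid refl =
  a+b≡c+e⇒a≡c-b+e (M₁-identity valid) , a+b+c≡d+e⇒a≡d-b-c+e (M₂-identity valid)
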